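{- For every positive integer $n$, $E_{r\to 1}(n) = \dfrac{5^{n+1}-2\cdot 3^{n+1} + 5}{4} - \left(\dfrac{5}{3}\right)^n = \dfrac{(3^n-1)(5^{n+1}-2\cdot 3^{n+1})+5^n-3^n}{4\cdot 3^n}$.
   Context: Consider the Tower of Hanoi with $3$ pegs (numbered $1,2,3$) and $n$ disks $D_1,\dots,D_n$ of sizes $1,\dots,n$. A state is an assignment of each disk to a peg; on each peg the disks are stacked with sizes decreasing from bottom to top, so there are $3^n$ states. A legal move takes the top disk of one peg and places it on top of another peg, provided that peg is empty or its top disk is larger than the moved disk. A random solution proceeds by repeatedly choosing the next move uniformly at random among all legal moves in the current state (independently of the past). $E_{r\to 1}(n)$ denotes the expected number of random moves needed to reach for the first time the state with all disks on peg $1$, when the starting state is chosen uniformly at random among all $3^n$ states (zero moves if the starting state is already that state). -}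

module Defs where

open import Data.Nat as ℕ using (ℕ; zero; suc; _^_; NonZero)
open import Data.Nat.Properties using (m^n≢0)
open import Data.Fin as Fin using (Fin; toℕ)
open import Data.Fin.Properties using () renaming (_≟_ to _≟F_)
open import Data.Vec as Vec using (Vec; []; _∷_; lookup; _[_]≔_; replicate)
open import Data.Vec.Properties using (≡-dec)
open import Data.List as List using (List; []; _∷_; map; concatMap; length; allFin; foldr)
open import Data.List.Base using (all)
open import Data.Bool using (Bool; true; false; if_then_else_; not; _∧_; _∨_)
open import Data.Integer as ℤ using (ℤ; +_)
open import Data.Rational as ℚ using (ℚ; 0ℚ; _/_; _+_; _*_; _-_; ∣_∣; _<_)
open import Data.Product using (∃; _×_)
open import Relation.Nullary.Decidable using (isYes)

-- Pegs 1,2,3 are represented by Fin 3 (0F = peg 1, 1F = peg 2, 2F = peg 3).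
Peg : Set
Peg = Fin 3

-- A state assigns a peg to each disk; index i : Fin n is disk D_{i+1}
-- (size i+1), so smaller index = smaller disk.
State : ℕ → Set
State n = Vec Peg n

allStates : (n : ℕ) → List (State n)
allStates zero    = [] ∷ []
allStates (suc n) = concatMap (λ p → map (p ∷_) (allStates n)) (allFin 3)

goal : (n : ℕ) → State n
goal n = replicate n Fin.zero

eqS : {n : ℕ} → State n → State n → Bool
eqS s t = isYes (≡-dec _≟F_ s t)

eqP : Peg → Peg → Bool
eqP p q = isYes (p ≟F q)

-- Moving disk i (on peg s[i]) to peg q is legal iff q ≠ s[i], disk i is
-- the top disk of its peg (no smaller disk on s[i]) and peg q is empty or
-- has a larger top disk (no smaller disk on q).
legal : {n : ℕ} → State n → Fin n → Peg → Bool
legal {n} s i q =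
  not (eqP q (lookup s i)) ∧
  all (λ j → not (toℕ j ℕ.<ᵇ toℕ i) ∨
             (not (eqP (lookup s j) (lookup s i)) ∧ not (eqP (lookup s j) q)))
      (allFin n)

successors : {n : ℕ} → State n → List (State n)
successors {n} s =
  concatMap (λ i → concatMap (λ q → if legal s i q then (s [ i ]≔ q) ∷ [] else [])
                             (allFin 3))
            (allFin n)

inv : ℕ → ℚ
inv zero    = 0ℚ
inv (suc k) = + 1 / suc k

Σ : {A : Set} → List A → (A → ℚ) → ℚ
Σ xs f = foldr (λ x acc → f x + acc) 0ℚ xs

-- alive n j t = P(X_j = t and the goal has not been visited at times 0..j),
-- for the random walk X started uniformly among the 3^n states.
alive : (n : ℕ) → ℕ → State n → ℚ
alive n zero    t = if eqS t (goal n) then 0ℚ else inv (3 ^ n)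
alive n (suc j) t =
  if eqS t (goal n) then 0ℚ
  else Σ (allStates n) (λ s →
         Σ (successors s) (λ u →
           if eqS u t then alive n j s * inv (length (successors s)) else 0ℚ))

-- P(T > j), T = first hitting time of the goal state
survival : (n : ℕ) → ℕ → ℚ
survival n j = Σ (allStates n) (alive n j)

-- partial sums Σ_{j<k} P(T > j); E[T] = Σ_{j ≥ 0} P(T > j)
partialExp : (n : ℕ) → ℕ → ℚ
partialExp n zero    = 0ℚ
partialExp n (suc k) = partialExp n k + survival n k

ConvergesTo : (ℕ → ℚ) → ℚ → Set
ConvergesTo f L = ∀ (ε : ℚ) → 0ℚ < ε → ∃ λ K → ∀ k → K ℕ.≤ k → ∣ f k - L ∣ < ε

formula1 : ℕ → ℚ
formula1 n =
  ((+ (5 ^ suc n) ℤ.- + (2 ℕ.* 3 ^ suc n) ℤ.+ + 5) / 4)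
  - ((+ (5 ^ n)) / (3 ^ n)) {{m^n≢0 3 n}}

formula2 : ℕ → ℚ
formula2 n =
  (((+ (3 ^ n) ℤ.- + 1) ℤ.* (+ (5 ^ suc n) ℤ.- + (2 ℕ.* 3 ^ suc n))
     ℤ.+ + (5 ^ n) ℤ.- + (3 ^ n)) / (3 ^ n)) {{m^n≢0 3 n}}
  * (+ 1 / 4)

-- Let T be the hitting time of the goal and h(s) the expected value of T from s. Then h vanishes
-- at the goal, is nonnegative, and elsewhere h(s) = 1 + (mean of h over the successors of s).
-- Conversely, for any such h the quantity R_k = E[h(X_k); T > k] satisfies
-- R_{k+1} = R_k - P(T > k); hence Σ_{j<k} P(T > j) = R_0 - R_k, and since R is decreasing and
-- R_k ≤ (Σ h)·P(T > k) we get k·R_k ≤ (Σ h)·R_0, so the partial sums converge to R_0.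
--
-- The function h is built by recursion over the disks. Its values on the three perfect towers
-- of the j+2 smallest disks (the corners) determine its values on the states where disk j+1 lies
-- on p and the j+1 smallest disks are stacked on r ≠ p: from there the walk reaches the corners
-- on p, r and the third peg with probabilities 1 - 3β_j, β_j, 2β_j after 3δ_j steps on average,
-- where δ_j = (5^(j+1) - 3^(j+1))/2 and β_j = δ_j/δ_(j+1). A state has two moves of its smallest
-- disk, and at most one other move, of the smallest disk not on the peg of the smallest one;
-- with these formulas the mean over all moves is a linear identity in the corner values, which
-- holds by two relations between β_j, δ_j and 3^j. Summing h over the 3^n states gives R_0.
module Submission where

open import Defs
open import Agda.Builtin.FromNat using (Number; fromNat)
open import Level using (0ℓ)
open import Function using (_∘_; id)
open import Data.Unit using (tt)
open import Data.Maybe using (Maybe; just; nothing)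
open import Data.Empty using (⊥-elim)
open import Data.Bool using (Bool; true; false; if_then_else_; not; _∧_; _∨_)
open import Data.Bool.Properties using (∧-assoc; ∧-comm; ∧-identityʳ) renaming (_≟_ to _≟ᵇ_)
open import Data.Sum using (_⊎_; inj₁; inj₂)
open import Data.Product using (∃; _×_; _,_; proj₁; proj₂)
open import Data.Nat as ℕ using (ℕ; zero; suc; _^_)
import Data.Nat.Literals
import Data.Nat.Properties as ℕ
open import Data.Integer as ℤ using (ℤ; 1ℤ)
import Data.Integer.Properties as ℤ
import Data.Integer.Tactic.RingSolver as ℤ-Solver
open import Data.Fin as Fin using (Fin; toℕ)
open import Data.Fin.Properties using (all?) renaming (_≟_ to _≟ᶠ_)
open import Data.Vec using ([]; _∷_; lookup; _[_]≔_; replicate)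
open import Data.Vec.Properties using (≡-dec; ∷-injective)
open import Data.List as List using (List; []; _∷_; _++_; map; concatMap; length; allFin; tabulate)
import Data.List.Properties as List
import Data.Bool.ListAction as Bool
open import Data.Rational
  using (ℚ; mkℚ; 0ℚ; 1ℚ; _+_; _*_; _-_; -_; _≤_; _<_; _/_; 1/_; ∣_∣; *<*; *≤*; NonZero; Positive; positive; nonNegative)
open import Data.Rational.Literals using (fromℤ)
import Data.Rational.Properties as ℚ
import Data.Rational.Unnormalised as ℚᵘ
import Data.Rational.Unnormalised.Properties as ℚᵘ
open import Relation.Nullary using (yes; no)
open import Relation.Nullary.Decidable using (from-yes)
open import Relation.Binary.PropositionalEquality
open import Tactic.RingSolver using (solve-∀)
import Tactic.RingSolver.Core.AlmostCommutativeRing as ACR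

instance
  ℕ-number : Number ℕ
  ℕ-number = Data.Nat.Literals.number

  ℚ-number : Number ℚ
  ℚ-number = Data.Rational.Literals.number

ℚ-ring : ACR.AlmostCommutativeRing 0ℓ 0ℓ
ℚ-ring = ACR.fromCommutativeRing ℚ.+-*-commutativeRing isZero
  where
  isZero : (p : ℚ) → Maybe (0ℚ ≡ p)
  isZero p with 0ℚ ℚ.≟ p
  ... | yes 0≡p = just 0≡p
  ... | no  _   = nothing

fromℕ : ℕ → ℚ
fromℕ n = fromℤ (ℤ.+ n)

fromℤ-+ : ∀ a b → fromℤ (a ℤ.+ b) ≡ fromℤ a + fromℤ b
fromℤ-+ a b = ℚ.toℚᵘ-injective (ℚᵘ.≃-sym (ℚᵘ.≃-trans (ℚ.toℚᵘ-homo-+ (fromℤ a) (fromℤ b)) (ℚᵘ.*≡* (cross a b))))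
  where
  cross : ∀ a b → (a ℤ.* 1ℤ ℤ.+ b ℤ.* 1ℤ) ℤ.* 1ℤ ≡ (a ℤ.+ b) ℤ.* (1ℤ ℤ.* 1ℤ)
  cross = ℤ-Solver.solve-∀

fromℤ-* : ∀ a b → fromℤ (a ℤ.* b) ≡ fromℤ a * fromℤ b
fromℤ-* a b = ℚ.toℚᵘ-injective (ℚᵘ.≃-sym (ℚᵘ.≃-trans (ℚ.toℚᵘ-homo-* (fromℤ a) (fromℤ b)) (ℚᵘ.*≡* (cross a b))))
  where
  cross : ∀ a b → (a ℤ.* b) ℤ.* 1ℤ ≡ (a ℤ.* b) ℤ.* (1ℤ ℤ.* 1ℤ)
  cross = ℤ-Solver.solve-∀

fromℤ-- : ∀ a b → fromℤ (a ℤ.- b) ≡ fromℤ a - fromℤ b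
fromℤ-- a b = trans (fromℤ-+ a (ℤ.- b)) (cong (fromℤ a +_) fromℤ-neg)
  where
  fromℤ-neg : fromℤ (ℤ.- b) ≡ - fromℤ b
  fromℤ-neg = ℚ.toℚᵘ-injective {fromℤ (ℤ.- b)} { - fromℤ b} (ℚᵘ.≃-sym (ℚ.toℚᵘ-homo‿- (fromℤ b)))

fromℕ-* : ∀ a b → fromℕ (a ℕ.* b) ≡ fromℕ a * fromℕ b
fromℕ-* a b = trans (cong fromℤ (ℤ.pos-* a b)) (fromℤ-* (ℤ.+ a) (ℤ.+ b))

fromℕ-mono-≤ : ∀ {a b} → a ℕ.≤ b → fromℕ a ≤ fromℕ b
fromℕ-mono-≤ a≤b = *≤* (ℤ.*-monoʳ-≤-nonNeg 1ℤ (ℤ.+≤+ a≤b))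

fromℕ-nonNeg : ∀ k → 0ℚ ≤ fromℕ k
fromℕ-nonNeg k = fromℕ-mono-≤ ℕ.z≤n

/-*-cancel : ∀ z n .{{_ : ℕ.NonZero n}} → (z / n) * fromℕ n ≡ fromℤ z
/-*-cancel z (suc k) = ℚ.toℚᵘ-injective (ℚᵘ.≃-trans (ℚ.toℚᵘ-homo-* (z / suc k) (fromℕ (suc k)))
  (ℚᵘ.≃-trans (ℚᵘ.*-congʳ (ℚ.toℚᵘ-fromℚᵘ (ℚᵘ.mkℚᵘ z k))) (ℚᵘ.*≡* (cross z (ℤ.+ suc k)))))
  where
  cross : ∀ z n → (z ℤ.* n) ℤ.* 1ℤ ≡ z ℤ.* (n ℤ.* 1ℤ)
  cross = ℤ-Solver.solve-∀

inv-*-cancel : ∀ k .{{_ : ℕ.NonZero k}} → inv k * fromℕ k ≡ 1ℚ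
inv-*-cancel (suc k) = /-*-cancel (ℤ.+ 1) (suc k)

/-as-* : ∀ z k .{{_ : ℕ.NonZero k}} → z / k ≡ fromℤ z * inv k
/-as-* z (suc k) = begin
  z / suc k                                   ≡⟨ ℚ.*-identityʳ (z / suc k) ⟨
  z / suc k * 1ℚ                              ≡⟨ cong (z / suc k *_) inverse ⟨
  z / suc k * (fromℕ (suc k) * inv (suc k))   ≡⟨ ℚ.*-assoc (z / suc k) _ _ ⟨
  z / suc k * fromℕ (suc k) * inv (suc k)     ≡⟨ cong (_* inv (suc k)) (/-*-cancel z (suc k)) ⟩
  fromℤ z * inv (suc k)                       ∎
  where
  open ≡-Reasoning
  inverse : fromℕ (suc k) * inv (suc k) ≡ 1ℚ
  inverse = trans (ℚ.*-comm (fromℕ (suc k)) (inv (suc k))) (inv-*-cancel (suc k))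

ℕ-above : ∀ q → ∃ λ K → q < fromℕ K
ℕ-above (mkℚ ℤ.-[1+ _ ] _ _) = 1 , *<* ℤ.-<+
ℕ-above (mkℚ (ℤ.+ k) d _)    =
  suc k , *<* (subst₂ ℤ._<_ (ℤ.pos-* k 1) (ℤ.pos-* (suc k) (suc d)) (ℤ.+<+ k*1<[1+k]*[1+d]))
  where
  k*1<[1+k]*[1+d] : k ℕ.* 1 ℕ.< suc k ℕ.* suc d
  k*1<[1+k]*[1+d] = ℕ.<-≤-trans (ℕ.s≤s (ℕ.≤-reflexive (ℕ.*-identityʳ k))) (ℕ.m≤m*n (suc k) (suc d))

archimedean : ∀ q ε → 0ℚ < ε → ∃ λ K → q < fromℕ K * ε
archimedean q ε 0<ε = K , subst (_< fromℕ K * ε) q/ε*ε≡q (ℚ.*-monoˡ-<-pos ε (proj₂ above))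
  where
  instance
    ε-positive : Positive ε
    ε-positive = positive 0<ε
    ε-nonZero : NonZero ε
    ε-nonZero = ℚ.pos⇒nonZero ε
  above : ∃ λ K → q * 1/ ε < fromℕ K
  above = ℕ-above (q * 1/ ε)
  K : ℕ
  K = proj₁ above
  q/ε*ε≡q : q * 1/ ε * ε ≡ q
  q/ε*ε≡q = trans (ℚ.*-assoc q _ ε) (trans (cong (q *_) (ℚ.*-inverseˡ ε)) (ℚ.*-identityʳ q))

*-nonNeg : ∀ {p q} → 0ℚ ≤ p → 0ℚ ≤ q → 0ℚ ≤ p * q
*-nonNeg {p} {q} 0≤p 0≤q =
  ℚ.nonNegative⁻¹ _ {{ℚ.nonNeg*nonNeg⇒nonNeg p {{nonNegative 0≤p}} q {{nonNegative 0≤q}}}}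

+-nonNeg : ∀ {p q} → 0ℚ ≤ p → 0ℚ ≤ q → 0ℚ ≤ p + q
+-nonNeg = ℚ.+-mono-≤

positive⇒nonNeg : ∀ p → .{{Positive p}} → 0ℚ ≤ p
positive⇒nonNeg p = ℚ.<⇒≤ (ℚ.positive⁻¹ p)

inv-nonNeg : ∀ k → 0ℚ ≤ inv k
inv-nonNeg zero    = ℚ.≤-refl
inv-nonNeg (suc k) = ℚ.nonNegative⁻¹ _ {{ℚ.normalize-nonNeg 1 (suc k)}}

if-*ʳ : ∀ (b : Bool) p q → (if b then p else 0ℚ) * q ≡ (if b then p * q else 0ℚ)
if-*ʳ true  p q = refl
if-*ʳ false p q = ℚ.*-zeroˡ q

module _ {A : Set} where

  Σ-++ : (xs ys : List A) (f : A → ℚ) → Σ (xs ++ ys) f ≡ Σ xs f + Σ ys f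
  Σ-++ []       ys f = sym (ℚ.+-identityˡ _)
  Σ-++ (x ∷ xs) ys f = trans (cong (f x +_) (Σ-++ xs ys f)) (sym (ℚ.+-assoc (f x) _ _))

  Σ-cong : (xs : List A) {f g : A → ℚ} → (∀ x → f x ≡ g x) → Σ xs f ≡ Σ xs g
  Σ-cong []       f≗g = refl
  Σ-cong (x ∷ xs) f≗g = cong₂ _+_ (f≗g x) (Σ-cong xs f≗g)

  Σ-zero : (xs : List A) → Σ xs (λ _ → 0ℚ) ≡ 0ℚ
  Σ-zero []       = refl
  Σ-zero (x ∷ xs) = trans (ℚ.+-identityˡ _) (Σ-zero xs)

  Σ-distrib-+ : (xs : List A) (f g : A → ℚ) → Σ xs (λ x → f x + g x) ≡ Σ xs f + Σ xs g
  Σ-distrib-+ []       f g = refl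
  Σ-distrib-+ (x ∷ xs) f g =
    trans (cong (f x + g x +_) (Σ-distrib-+ xs f g)) (interchange (f x) (g x) (Σ xs f) (Σ xs g))
    where
    interchange : ∀ a b c d → (a + b) + (c + d) ≡ (a + c) + (b + d)
    interchange = solve-∀ ℚ-ring

  Σ-distrib-- : (xs : List A) (f g : A → ℚ) → Σ xs (λ x → f x - g x) ≡ Σ xs f - Σ xs g
  Σ-distrib-- []       f g = refl
  Σ-distrib-- (x ∷ xs) f g =
    trans (cong (f x - g x +_) (Σ-distrib-- xs f g)) (interchange (f x) (g x) (Σ xs f) (Σ xs g))
    where
    interchange : ∀ a b c d → (a - b) + (c - d) ≡ (a + c) - (b + d)
    interchange = solve-∀ ℚ-ring

  *-distribˡ-Σ : (c : ℚ) (xs : List A) (f : A → ℚ) → c * Σ xs f ≡ Σ xs (λ x → c * f x)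
  *-distribˡ-Σ c []       f = ℚ.*-zeroʳ c
  *-distribˡ-Σ c (x ∷ xs) f = trans (ℚ.*-distribˡ-+ c (f x) _) (cong (c * f x +_) (*-distribˡ-Σ c xs f))

  *-distribʳ-Σ : (c : ℚ) (xs : List A) (f : A → ℚ) → Σ xs f * c ≡ Σ xs (λ x → f x * c)
  *-distribʳ-Σ c xs f = trans (ℚ.*-comm _ c) (trans (*-distribˡ-Σ c xs f) (Σ-cong xs (λ x → ℚ.*-comm c (f x))))

  Σ-mono-≤ : (xs : List A) {f g : A → ℚ} → (∀ x → f x ≤ g x) → Σ xs f ≤ Σ xs g
  Σ-mono-≤ []       f≤g = ℚ.≤-refl
  Σ-mono-≤ (x ∷ xs) f≤g = ℚ.+-mono-≤ (f≤g x) (Σ-mono-≤ xs f≤g)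

  Σ-nonNeg : (xs : List A) {f : A → ℚ} → (∀ x → 0ℚ ≤ f x) → 0ℚ ≤ Σ xs f
  Σ-nonNeg xs 0≤f = ℚ.≤-trans (ℚ.≤-reflexive (sym (Σ-zero xs))) (Σ-mono-≤ xs 0≤f)

module _ {A B : Set} where

  Σ-map : (g : A → B) (xs : List A) (f : B → ℚ) → Σ (map g xs) f ≡ Σ xs (λ x → f (g x))
  Σ-map g []       f = refl
  Σ-map g (x ∷ xs) f = cong (f (g x) +_) (Σ-map g xs f)

  Σ-concatMap : (g : A → List B) (xs : List A) (f : B → ℚ) →
                Σ (concatMap g xs) f ≡ Σ xs (λ x → Σ (g x) f)
  Σ-concatMap g []       f = refl
  Σ-concatMap g (x ∷ xs) f = trans (Σ-++ (g x) (concatMap g xs) f) (cong (Σ (g x) f +_) (Σ-concatMap g xs f))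

  Σ-comm : (xs : List A) (ys : List B) (F : A → B → ℚ) →
           Σ xs (λ x → Σ ys (F x)) ≡ Σ ys (λ y → Σ xs (λ x → F x y))
  Σ-comm []       ys F = sym (Σ-zero ys)
  Σ-comm (x ∷ xs) ys F =
    trans (cong (Σ ys (F x) +_) (Σ-comm xs ys F)) (sym (Σ-distrib-+ ys (F x) (λ y → Σ xs (λ x′ → F x′ y))))

pattern peg₁ = Fin.zero
pattern peg₂ = Fin.suc Fin.zero
pattern peg₃ = Fin.suc (Fin.suc Fin.zero)

third : Peg → Peg → Peg
third peg₁ peg₂ = peg₃
third peg₁ peg₃ = peg₂
third peg₂ peg₁ = peg₃
third peg₂ peg₃ = peg₁
third peg₃ peg₁ = peg₂
third peg₃ peg₂ = peg₁
third p    _    = p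

eqP-refl : ∀ p → eqP p p ≡ true
eqP-refl peg₁ = refl
eqP-refl peg₂ = refl
eqP-refl peg₃ = refl

eqP-true⇒≡ : ∀ {p q} → eqP p q ≡ true → p ≡ q
eqP-true⇒≡ {p} {q} _ with p ≟ᶠ q
eqP-true⇒≡ _ | yes p≡q = p≡q

module _ {n : ℕ} where

  eqS-refl : (s : State n) → eqS s s ≡ true
  eqS-refl s with ≡-dec _≟ᶠ_ s s
  ... | yes _   = refl
  ... | no  s≢s = ⊥-elim (s≢s refl)

  eqS-true⇒≡ : {s t : State n} → eqS s t ≡ true → s ≡ t
  eqS-true⇒≡ {s} {t} _ with ≡-dec _≟ᶠ_ s t
  eqS-true⇒≡ _ | yes s≡t = s≡t

  eqS-false : {s t : State n} → s ≢ t → eqS s t ≡ false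
  eqS-false {s} {t} s≢t with ≡-dec _≟ᶠ_ s t
  ... | yes s≡t = ⊥-elim (s≢t s≡t)
  ... | no  _   = refl

Σ-pegs-point : (f : Peg → ℚ) (x : Peg) → (∀ p → p ≢ x → f p ≡ 0ℚ) → Σ (allFin 3) f ≡ f x
Σ-pegs-point f peg₁ f≗0 rewrite f≗0 peg₂ (λ ()) | f≗0 peg₃ (λ ()) = ℚ.+-identityʳ _
Σ-pegs-point f peg₂ f≗0 rewrite f≗0 peg₁ (λ ()) | f≗0 peg₃ (λ ()) = trans (ℚ.+-identityˡ _) (ℚ.+-identityʳ _)
Σ-pegs-point f peg₃ f≗0 rewrite f≗0 peg₁ (λ ()) | f≗0 peg₂ (λ ()) =
  trans (ℚ.+-identityˡ _) (trans (ℚ.+-identityˡ _) (ℚ.+-identityʳ _))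

Σ-allStates-suc : (n : ℕ) (f : State (suc n) → ℚ) →
                  Σ (allStates (suc n)) f ≡ Σ (allFin 3) (λ p → Σ (allStates n) (λ t → f (p ∷ t)))
Σ-allStates-suc n f = trans (Σ-concatMap (λ p → map (p ∷_) (allStates n)) (allFin 3) f)
                            (Σ-cong (allFin 3) (λ p → Σ-map (p ∷_) (allStates n) f))

Σ-allStates-point : (n : ℕ) (f : State n → ℚ) (u : State n) → (∀ t → t ≢ u → f t ≡ 0ℚ) →
                    Σ (allStates n) f ≡ f u
Σ-allStates-point zero    f [] _ = ℚ.+-identityʳ (f [])
Σ-allStates-point (suc n) f (x ∷ u) f≗0 = begin
  Σ (allStates (suc n)) f                                   ≡⟨ Σ-allStates-suc n f ⟩
  Σ (allFin 3) (λ p → Σ (allStates n) (λ t → f (p ∷ t)))   ≡⟨ Σ-pegs-point _ x off-x ⟩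
  Σ (allStates n) (λ t → f (x ∷ t))                         ≡⟨ Σ-allStates-point n _ u off-u ⟩
  f (x ∷ u)                                                 ∎
  where
  open ≡-Reasoning
  off-x : ∀ p → p ≢ x → Σ (allStates n) (λ t → f (p ∷ t)) ≡ 0ℚ
  off-x p p≢x = trans (Σ-cong (allStates n) (λ t → f≗0 _ (p≢x ∘ proj₁ ∘ ∷-injective))) (Σ-zero (allStates n))
  off-u : ∀ t → t ≢ u → f (x ∷ t) ≡ 0ℚ
  off-u t t≢u = f≗0 _ (t≢u ∘ proj₂ ∘ ∷-injective)

Σ-allStates-indicator : (n : ℕ) (u : State n) (g : State n → ℚ) →
                        Σ (allStates n) (λ t → if eqS u t then g t else 0ℚ) ≡ g u
Σ-allStates-indicator n u g =
  trans (Σ-allStates-point n _ u off-u) (cong (λ b → if b then g u else 0ℚ) (eqS-refl u))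
  where
  off-u : ∀ t → t ≢ u → (if eqS u t then g t else 0ℚ) ≡ 0ℚ
  off-u t t≢u rewrite eqS-false (t≢u ∘ sym) = refl

-- Hitting potentials

average : {A : Set} → List A → (A → ℚ) → ℚ
average xs f = inv (length xs) * Σ xs f

record HittingPotential (n : ℕ) : Set where
  field
    h          : State n → ℚ
    h-goal     : h (goal n) ≡ 0ℚ
    h-nonNeg   : ∀ s → 0ℚ ≤ h s
    h-harmonic : ∀ s → s ≢ goal n → average (successors s) h ≡ h s - 1ℚ

module _ {n : ℕ} where

  alive-goal : ∀ k → alive n k (goal n) ≡ 0ℚ
  alive-goal zero    rewrite eqS-refl (goal n) = refl
  alive-goal (suc k) rewrite eqS-refl (goal n) = refl

  alive-nonNeg : ∀ k t → 0ℚ ≤ alive n k t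
  alive-nonNeg zero t with eqS t (goal n)
  ... | true  = ℚ.≤-refl
  ... | false = inv-nonNeg (3 ^ n)
  alive-nonNeg (suc k) t with eqS t (goal n)
  ... | true  = ℚ.≤-refl
  ... | false = Σ-nonNeg (allStates n) λ s → Σ-nonNeg (successors s) λ u → move-nonNeg s (eqS u t)
    where
    move-nonNeg : ∀ s b → 0ℚ ≤ (if b then alive n k s * inv (length (successors s)) else 0ℚ)
    move-nonNeg s true  = *-nonNeg (alive-nonNeg k s) (inv-nonNeg (length (successors s)))
    move-nonNeg s false = ℚ.≤-refl

  survival-nonNeg : ∀ k → 0ℚ ≤ survival n k
  survival-nonNeg k = Σ-nonNeg (allStates n) (alive-nonNeg k)

module _ {n : ℕ} (P : HittingPotential n) where

  open HittingPotential P

  -- remaining k = E[h(X_k); T > k]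
  remaining : ℕ → ℚ
  remaining k = Σ (allStates n) (λ t → alive n k t * h t)

  total : ℚ
  total = Σ (allStates n) h

  weight : ℕ → State n → ℚ
  weight k s = alive n k s * inv (length (successors s))

  goal-test-* : ∀ t c → (if eqS t (goal n) then 0ℚ else c) * h t ≡ c * h t
  goal-test-* t c with eqS t (goal n) in t≟goal
  ... | true  = trans (ℚ.*-zeroˡ (h t)) (sym (trans (cong (c *_) h[t]≡0) (ℚ.*-zeroʳ c)))
    where
    h[t]≡0 : h t ≡ 0ℚ
    h[t]≡0 = trans (cong h (eqS-true⇒≡ t≟goal)) h-goal
  ... | false = refl

  alive-suc-* : ∀ k t → alive n (suc k) t * h t ≡
    Σ (allStates n) (λ s → Σ (successors s) (λ u → if eqS u t then weight k s * h t else 0ℚ))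
  alive-suc-* k t = trans (goal-test-* t _)
    (trans (*-distribʳ-Σ (h t) (allStates n) (λ s → Σ (successors s) (inflow s)))
           (Σ-cong (allStates n) (λ s → trans (*-distribʳ-Σ (h t) (successors s) (inflow s))
                                              (Σ-cong (successors s) (λ u → if-*ʳ (eqS u t) (weight k s) (h t))))))
    where
    inflow : State n → State n → ℚ
    inflow s u = if eqS u t then weight k s else 0ℚ

  weight-*-Σ : ∀ k s → weight k s * Σ (successors s) h ≡ alive n k s * h s - alive n k s
  weight-*-Σ k s with ≡-dec _≟ᶠ_ s (goal n)
  ... | yes refl rewrite alive-goal {n} k = vanish (inv (length (successors (goal n)))) _ (h (goal n))
    where
    vanish : ∀ a b c → 0ℚ * a * b ≡ 0ℚ * c - 0ℚ
    vanish = solve-∀ ℚ-ring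
  ... | no s≢goal = begin
    alive n k s * inv (length (successors s)) * Σ (successors s) h  ≡⟨ ℚ.*-assoc (alive n k s) _ _ ⟩
    alive n k s * average (successors s) h                          ≡⟨ cong (alive n k s *_) (h-harmonic s s≢goal) ⟩
    alive n k s * (h s - 1ℚ)                                        ≡⟨ expand (alive n k s) (h s) ⟩
    alive n k s * h s - alive n k s                                 ∎
    where
    open ≡-Reasoning
    expand : ∀ a b → a * (b - 1ℚ) ≡ a * b - a
    expand = solve-∀ ℚ-ring

  remaining-suc : ∀ k → remaining (suc k) ≡ remaining k - survival n k
  remaining-suc k = begin
    remaining (suc k)
      ≡⟨ Σ-cong SS (alive-suc-* k) ⟩
    Σ SS (λ t → Σ SS (λ s → Σ (successors s) (λ u → F s u t)))
      ≡⟨ Σ-comm SS SS (λ t s → Σ (successors s) (λ u → F s u t)) ⟩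
    Σ SS (λ s → Σ SS (λ t → Σ (successors s) (λ u → F s u t)))
      ≡⟨ Σ-cong SS (λ s → Σ-comm SS (successors s) (λ t u → F s u t)) ⟩
    Σ SS (λ s → Σ (successors s) (λ u → Σ SS (λ t → F s u t)))
      ≡⟨ Σ-cong SS (λ s → Σ-cong (successors s) (λ u → Σ-allStates-indicator n u (λ t → weight k s * h t))) ⟩
    Σ SS (λ s → Σ (successors s) (λ u → weight k s * h u))
      ≡⟨ Σ-cong SS (λ s → sym (*-distribˡ-Σ (weight k s) (successors s) h)) ⟩
    Σ SS (λ s → weight k s * Σ (successors s) h)
      ≡⟨ Σ-cong SS (weight-*-Σ k) ⟩
    Σ SS (λ s → alive n k s * h s - alive n k s)
      ≡⟨ Σ-distrib-- SS (λ s → alive n k s * h s) (alive n k) ⟩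
    remaining k - survival n k ∎
    where
    open ≡-Reasoning
    SS : List (State n)
    SS = allStates n
    F : State n → State n → State n → ℚ
    F s u t = if eqS u t then weight k s * h t else 0ℚ

  remaining-zero : remaining 0 ≡ inv (3 ^ n) * total
  remaining-zero = trans (Σ-cong (allStates n) (λ t → goal-test-* t (inv (3 ^ n))))
                         (sym (*-distribˡ-Σ (inv (3 ^ n)) (allStates n) h))

  partialExp+remaining : ∀ k → partialExp n k + remaining k ≡ remaining 0
  partialExp+remaining zero    = ℚ.+-identityˡ _
  partialExp+remaining (suc k) =
    trans (cong (partialExp n k + survival n k +_) (remaining-suc k))
          (trans (cancel (partialExp n k) (survival n k) (remaining k)) (partialExp+remaining k))
    where
    cancel : ∀ a b c → (a + b) + (c - b) ≡ a + c
    cancel = solve-∀ ℚ-ring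

  remaining-nonNeg : ∀ k → 0ℚ ≤ remaining k
  remaining-nonNeg k = Σ-nonNeg (allStates n) (λ t → *-nonNeg (alive-nonNeg k t) (h-nonNeg t))

  remaining-antitone : ∀ k → remaining (suc k) ≤ remaining k
  remaining-antitone k = begin
    remaining (suc k)             ≡⟨ remaining-suc k ⟩
    remaining k - survival n k    ≤⟨ ℚ.+-monoʳ-≤ (remaining k) (ℚ.neg-antimono-≤ (survival-nonNeg {n} k)) ⟩
    remaining k - 0ℚ              ≡⟨ ℚ.+-identityʳ (remaining k) ⟩
    remaining k                   ∎
    where open ℚ.≤-Reasoning

  h≤total : ∀ s → h s ≤ total
  h≤total s = begin
    h s                                                   ≡⟨ Σ-allStates-indicator n s h ⟨
    Σ (allStates n) (λ t → if eqS s t then h t else 0ℚ)   ≤⟨ Σ-mono-≤ (allStates n) (λ t → drop-test (eqS s t) t) ⟩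
    total                                                 ∎
    where
    open ℚ.≤-Reasoning
    drop-test : ∀ b t → (if b then h t else 0ℚ) ≤ h t
    drop-test true  t = ℚ.≤-refl
    drop-test false t = h-nonNeg t

  remaining≤total*survival : ∀ k → remaining k ≤ total * survival n k
  remaining≤total*survival k = begin
    remaining k                                    ≤⟨ Σ-mono-≤ (allStates n) (λ t →
                                                        ℚ.*-monoˡ-≤-nonNeg (alive n k t) {{nonNegative (alive-nonNeg k t)}} (h≤total t)) ⟩
    Σ (allStates n) (λ t → alive n k t * total)    ≡⟨ *-distribʳ-Σ total (allStates n) (alive n k) ⟨
    survival n k * total                           ≡⟨ ℚ.*-comm (survival n k) total ⟩
    total * survival n k                           ∎
    where open ℚ.≤-Reasoning

  fromℕ*remaining≤ : ∀ k → fromℕ k * remaining k ≤ total * partialExp n k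
  fromℕ*remaining≤ zero    = ℚ.≤-reflexive (trans (ℚ.*-zeroˡ (remaining 0)) (sym (ℚ.*-zeroʳ total)))
  fromℕ*remaining≤ (suc k) = begin
    fromℕ (suc k) * remaining (suc k)                  ≡⟨ cong (_* remaining (suc k)) (fromℤ-+ 1ℤ (ℤ.+ k)) ⟩
    (1ℚ + fromℕ k) * remaining (suc k)                 ≡⟨ split (fromℕ k) (remaining (suc k)) ⟩
    fromℕ k * remaining (suc k) + remaining (suc k)    ≤⟨ ℚ.+-mono-≤
      (ℚ.*-monoˡ-≤-nonNeg (fromℕ k) {{nonNegative (fromℕ-nonNeg k)}} (remaining-antitone k))
      (ℚ.≤-trans (remaining-antitone k) (remaining≤total*survival k)) ⟩
    fromℕ k * remaining k + total * survival n k       ≤⟨ ℚ.+-monoˡ-≤ (total * survival n k) (fromℕ*remaining≤ k) ⟩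
    total * partialExp n k + total * survival n k      ≡⟨ ℚ.*-distribˡ-+ total (partialExp n k) (survival n k) ⟨
    total * partialExp n (suc k)                       ∎
    where
    open ℚ.≤-Reasoning
    split : ∀ a b → (1ℚ + a) * b ≡ a * b + b
    split = solve-∀ ℚ-ring

  partialExp≤remaining₀ : ∀ k → partialExp n k ≤ remaining 0
  partialExp≤remaining₀ k = begin
    partialExp n k                  ≡⟨ ℚ.+-identityʳ (partialExp n k) ⟨
    partialExp n k + 0ℚ             ≤⟨ ℚ.+-monoʳ-≤ (partialExp n k) (remaining-nonNeg k) ⟩
    partialExp n k + remaining k    ≡⟨ partialExp+remaining k ⟩
    remaining 0                     ∎
    where open ℚ.≤-Reasoning

  partialExp-converges : ConvergesTo (partialExp n) (remaining 0)
  partialExp-converges ε 0<ε = K , λ k K≤k → subst (_< ε) (sym (distance k)) (remaining<ε k K≤k)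
    where
    total-nonNeg : 0ℚ ≤ total
    total-nonNeg = Σ-nonNeg (allStates n) h-nonNeg
    K : ℕ
    K = proj₁ (archimedean (total * remaining 0) ε 0<ε)
    remaining<ε : ∀ k → K ℕ.≤ k → remaining k < ε
    remaining<ε k K≤k = ℚ.*-cancelˡ-<-nonNeg (fromℕ k) {{nonNegative (fromℕ-nonNeg k)}} (begin-strict
      fromℕ k * remaining k      ≤⟨ fromℕ*remaining≤ k ⟩
      total * partialExp n k     ≤⟨ ℚ.*-monoˡ-≤-nonNeg total {{nonNegative total-nonNeg}} (partialExp≤remaining₀ k) ⟩
      total * remaining 0        <⟨ proj₂ (archimedean (total * remaining 0) ε 0<ε) ⟩
      fromℕ K * ε                ≤⟨ ℚ.*-monoʳ-≤-nonNeg ε {{nonNegative (ℚ.<⇒≤ 0<ε)}} (fromℕ-mono-≤ K≤k) ⟩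
      fromℕ k * ε                ∎)
      where open ℚ.≤-Reasoning
    distance : ∀ k → ∣ partialExp n k - remaining 0 ∣ ≡ remaining k
    distance k = begin
      ∣ partialExp n k - remaining 0 ∣                      ≡⟨ cong (λ x → ∣ partialExp n k - x ∣) (partialExp+remaining k) ⟨
      ∣ partialExp n k - (partialExp n k + remaining k) ∣   ≡⟨ cong ∣_∣ (cancel (partialExp n k) (remaining k)) ⟩
      ∣ - remaining k ∣                                     ≡⟨ ℚ.∣-p∣≡∣p∣ (remaining k) ⟩
      ∣ remaining k ∣                                       ≡⟨ ℚ.0≤p⇒∣p∣≡p (remaining-nonNeg k) ⟩
      remaining k                                           ∎
      where
      open ≡-Reasoning
      cancel : ∀ a b → a - (a + b) ≡ - b
      cancel = solve-∀ ℚ-ring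

-- Legal moves

clear : Peg → Peg → Peg → Bool
clear x from to = not (eqP x from) ∧ not (eqP x to)

four-pegs-check : ∀ x y from to → eqP x y ∨ not (clear x from to ∧ (clear y from to ∧ not (eqP to from))) ≡ true
four-pegs-check = from-yes (all? λ x → all? λ y → all? λ from → all? λ to →
  eqP x y ∨ not (clear x from to ∧ (clear y from to ∧ not (eqP to from))) ≟ᵇ true)

no-four-distinct-pegs : ∀ x y from to → x ≢ y → clear x from to ∧ (clear y from to ∧ not (eqP to from)) ≡ false
no-four-distinct-pegs x y from to x≢y with eqP x y in x≟y | four-pegs-check x y from to
... | true  | _ = ⊥-elim (x≢y (eqP-true⇒≡ x≟y))
... | false | _ with clear x from to ∧ (clear y from to ∧ not (eqP to from))
...   | false = refl

movesWhere : {n : ℕ} → (Fin n → Peg → Bool) → State n → List (State n)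
movesWhere {n} P s = concatMap (λ i → concatMap (λ q → if P i q then (s [ i ]≔ q) ∷ [] else []) (allFin 3)) (allFin n)

headMoves : {n : ℕ} → (Peg → Bool) → State n → List (State (suc n))
headMoves C s = concatMap (λ q → if C q then (q ∷ s) ∷ [] else []) (allFin 3)

smallestDiskMoves : {n : ℕ} → Peg → State n → List (State (suc n))
smallestDiskMoves x = headMoves (λ q → not (eqP q x))

movesAvoiding : {n : ℕ} → Peg → State n → List (State n)
movesAvoiding x s = movesWhere (λ i q → clear x (lookup s i) q ∧ legal s i q) s

module _ {n : ℕ} where

  movesWhere-cong : {P Q : Fin n → Peg → Bool} → (∀ i q → P i q ≡ Q i q) → (s : State n) →
                    movesWhere P s ≡ movesWhere Q s
  movesWhere-cong P≗Q s = List.concatMap-cong (λ i →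
    List.concatMap-cong (λ q → cong (λ b → if b then (s [ i ]≔ q) ∷ [] else []) (P≗Q i q)) (allFin 3)) (allFin n)

  headMoves-cong : {C D : Peg → Bool} → (∀ q → C q ≡ D q) → (s : State n) → headMoves C s ≡ headMoves D s
  headMoves-cong C≗D s = List.concatMap-cong (λ q → cong (λ b → if b then (q ∷ s) ∷ [] else []) (C≗D q)) (allFin 3)

  movesWhere-none : (s : State n) → movesWhere (λ _ _ → false) s ≡ []
  movesWhere-none s = none (allFin n)
    where
    none : (is : List (Fin n)) → concatMap {B = State n} (λ _ → concatMap (λ _ → []) (allFin 3)) is ≡ []
    none []       = refl
    none (_ ∷ is) = none is

  movesWhere-∷ : (P : Fin (suc n) → Peg → Bool) (x : Peg) (s : State n) →
                 movesWhere P (x ∷ s) ≡ headMoves (P Fin.zero) s ++ map (x ∷_) (movesWhere (P ∘ Fin.suc) s)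
  movesWhere-∷ P x s = cong (headMoves (P Fin.zero) s ++_) (begin
    concatMap F (tabulate Fin.suc)                   ≡⟨ cong List.concat (List.map-tabulate Fin.suc F) ⟩
    List.concat (tabulate (F ∘ Fin.suc))             ≡⟨ cong List.concat (List.map-tabulate id (F ∘ Fin.suc)) ⟨
    concatMap (F ∘ Fin.suc) (allFin n)               ≡⟨ List.concatMap-cong (λ i → trans
                                                          (List.concatMap-cong (λ q → map-if (P (Fin.suc i) q) (s [ i ]≔ q)) (allFin 3))
                                                          (sym (List.map-concatMap (x ∷_) (G i) (allFin 3)))) (allFin n) ⟩
    concatMap (λ i → map (x ∷_) (concatMap (G i) (allFin 3))) (allFin n)
                                                     ≡⟨ List.map-concatMap (x ∷_) (λ i → concatMap (G i) (allFin 3)) (allFin n) ⟨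
    map (x ∷_) (movesWhere (P ∘ Fin.suc) s)          ∎)
    where
    open ≡-Reasoning
    F : Fin (suc n) → List (State (suc n))
    F i = concatMap (λ q → if P i q then ((x ∷ s) [ i ]≔ q) ∷ [] else []) (allFin 3)
    G : Fin n → Peg → List (State n)
    G i q = if P (Fin.suc i) q then (s [ i ]≔ q) ∷ [] else []
    map-if : ∀ b (t : State n) → (if b then (x ∷ t) ∷ [] else []) ≡ map (x ∷_) (if b then t ∷ [] else [])
    map-if true  t = refl
    map-if false t = refl

  legal-head : (x : Peg) (s : State n) (q : Peg) → legal (x ∷ s) Fin.zero q ≡ not (eqP q x)
  legal-head x s q = trans (cong (not (eqP q x) ∧_) (all-true (allFin (suc n)))) (∧-identityʳ _)
    where
    all-true : {A : Set} (xs : List A) → Bool.all (λ _ → true) xs ≡ true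
    all-true []       = refl
    all-true (_ ∷ xs) = all-true xs

  legal-tail : (x : Peg) (s : State n) (i : Fin n) (q : Peg) →
               legal (x ∷ s) (Fin.suc i) q ≡ clear x (lookup s i) q ∧ legal s i q
  legal-tail x s i q = trans (cong (λ rest → not (eqP q (lookup s i)) ∧ (clear x (lookup s i) q ∧ rest)) (begin
      Bool.and (map P (tabulate Fin.suc))        ≡⟨ cong Bool.and (List.map-tabulate Fin.suc P) ⟩
      Bool.and (tabulate (P ∘ Fin.suc))          ≡⟨ cong Bool.and (List.map-tabulate id (P ∘ Fin.suc)) ⟨
      Bool.and (map (P ∘ Fin.suc) (allFin n))    ∎))
    (swap (not (eqP q (lookup s i))) (clear x (lookup s i) q) _)
    where
    open ≡-Reasoning
    P : Fin (suc n) → Bool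
    P j = not (toℕ j ℕ.<ᵇ toℕ (Fin.suc i)) ∨
          (not (eqP (lookup (x ∷ s) j) (lookup s i)) ∧ not (eqP (lookup (x ∷ s) j) q))
    swap : ∀ a b c → a ∧ (b ∧ c) ≡ b ∧ (a ∧ c)
    swap a b c = trans (sym (∧-assoc a b c)) (trans (cong (_∧ c) (∧-comm a b)) (∧-assoc b a c))

  successors-∷ : (x : Peg) (s : State n) → successors (x ∷ s) ≡ smallestDiskMoves x s ++ map (x ∷_) (movesAvoiding x s)
  successors-∷ x s = trans (movesWhere-∷ (legal (x ∷ s)) x s)
    (cong₂ (λ hs ts → hs ++ map (x ∷_) ts) (headMoves-cong (legal-head x s) s) (movesWhere-cong (legal-tail x s) s))

  movesAvoiding-same : (x : Peg) (s : State n) → movesAvoiding x (x ∷ s) ≡ map (x ∷_) (movesAvoiding x s)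
  movesAvoiding-same x s = trans (movesWhere-∷ (λ i q → clear x (lookup (x ∷ s) i) q ∧ legal (x ∷ s) i q) x s)
    (cong₂ (λ hs ts → hs ++ map (x ∷_) ts)
      (headMoves-cong (λ q → cong (λ b → (not b ∧ not (eqP x q)) ∧ legal (x ∷ s) Fin.zero q) (eqP-refl x)) s)
      (movesWhere-cong (λ i q → trans (cong (clear x (lookup s i) q ∧_) (legal-tail x s i q))
                                      (twice (clear x (lookup s i) q) (legal s i q))) s))
    where
    twice : ∀ a b → a ∧ (a ∧ b) ≡ a ∧ b
    twice true  b = refl
    twice false b = refl

  movesAvoiding-other : (x y : Peg) (s : State n) → x ≢ y → movesAvoiding x (y ∷ s) ≡ (third x y ∷ s) ∷ []
  movesAvoiding-other x y s x≢y = trans (movesWhere-∷ (λ i q → clear x (lookup (y ∷ s) i) q ∧ legal (y ∷ s) i q) y s)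
    (trans (cong₂ (λ hs ts → hs ++ map (y ∷_) ts)
             (trans (headMoves-cong (λ q → cong (clear x y q ∧_) (legal-head y s q)) s) (bridge-move x y x≢y))
             (trans (movesWhere-cong blocked s) (movesWhere-none s)))
           (List.++-identityʳ _))
    where
    bridge-move : ∀ x y → x ≢ y → headMoves (λ q → clear x y q ∧ not (eqP q y)) s ≡ (third x y ∷ s) ∷ []
    bridge-move peg₁ peg₁ x≢y = ⊥-elim (x≢y refl)
    bridge-move peg₁ peg₂ _   = refl
    bridge-move peg₁ peg₃ _   = refl
    bridge-move peg₂ peg₁ _   = refl
    bridge-move peg₂ peg₂ x≢y = ⊥-elim (x≢y refl)
    bridge-move peg₂ peg₃ _   = refl
    bridge-move peg₃ peg₁ _   = refl
    bridge-move peg₃ peg₂ _   = refl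
    bridge-move peg₃ peg₃ x≢y = ⊥-elim (x≢y refl)
    blocked : ∀ i q → clear x (lookup s i) q ∧ legal (y ∷ s) (Fin.suc i) q ≡ false
    blocked i q = begin
      clear x a q ∧ legal (y ∷ s) (Fin.suc i) q               ≡⟨ cong (clear x a q ∧_) (legal-tail y s i q) ⟩
      clear x a q ∧ (clear y a q ∧ (not (eqP q a) ∧ rest))    ≡⟨ regroup (clear x a q) (clear y a q) (not (eqP q a)) rest ⟩
      (clear x a q ∧ (clear y a q ∧ not (eqP q a))) ∧ rest    ≡⟨ cong (_∧ rest) (no-four-distinct-pegs x y a q x≢y) ⟩
      false                                                   ∎
      where
      open ≡-Reasoning
      a : Peg
      a = lookup s i
      rest : Bool
      rest = Bool.all _ (allFin n)
      regroup : ∀ b c d e → b ∧ (c ∧ (d ∧ e)) ≡ (b ∧ (c ∧ d)) ∧ e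
      regroup b c d e = trans (cong (b ∧_) (sym (∧-assoc c d e))) (sym (∧-assoc b (c ∧ d) e))

-- FirstOff r t locates the smallest disk of t that is not on peg r.
data FirstOff (r : Peg) : {m : ℕ} → State m → Set where
  here  : ∀ {m p} {rest : State m} → r ≢ p → FirstOff r (p ∷ rest)
  there : ∀ {m} {t : State m} → FirstOff r t → FirstOff r (r ∷ t)

bridge : ∀ {r m} {t : State m} → FirstOff r t → State m
bridge {r} (here {p = p} {rest} _) = third r p ∷ rest
bridge {r} (there off)             = r ∷ bridge off

movesAvoiding-firstOff : ∀ {r m} {t : State m} (off : FirstOff r t) → movesAvoiding r t ≡ bridge off ∷ []
movesAvoiding-firstOff {r} (here {p = p} {rest} r≢p) = movesAvoiding-other r p rest r≢p
movesAvoiding-firstOff {r} (there {t = t} off)       = trans (movesAvoiding-same r t) (cong (map (r ∷_)) (movesAvoiding-firstOff off))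

movesAvoiding-tower : (r : Peg) (m : ℕ) → movesAvoiding r (replicate m r) ≡ []
movesAvoiding-tower r zero    = refl
movesAvoiding-tower r (suc m) = trans (movesAvoiding-same r (replicate m r)) (cong (map (r ∷_)) (movesAvoiding-tower r m))

tower-or-firstOff : (r : Peg) {m : ℕ} (t : State m) → t ≡ replicate m r ⊎ FirstOff r t
tower-or-firstOff r []      = inj₁ refl
tower-or-firstOff r (p ∷ t) with r ≟ᶠ p
... | no  r≢p  = inj₂ (here r≢p)
... | yes refl with tower-or-firstOff r t
...   | inj₁ t≡tower = inj₁ (cong (r ∷_) t≡tower)
...   | inj₂ off     = inj₂ (there off)

-- The Hanoi potential

pow₃ : ℕ → ℚ
pow₃ zero    = 1
pow₃ (suc j) = 3 * pow₃ j

δ : ℕ → ℚ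
δ zero    = 1
δ (suc j) = 5 * δ j + 3 * pow₃ j

pow₃-positive : ∀ j → Positive (pow₃ j)
pow₃-positive zero    = _
pow₃-positive (suc j) = ℚ.pos*pos⇒pos 3 (pow₃ j) {{pow₃-positive j}}

δ-positive : ∀ j → Positive (δ j)
δ-positive zero    = _
δ-positive (suc j) = ℚ.pos+pos⇒pos (5 * δ j) {{ℚ.pos*pos⇒pos 5 (δ j) {{δ-positive j}}}}
                                   (3 * pow₃ j) {{ℚ.pos*pos⇒pos 3 (pow₃ j) {{pow₃-positive j}}}}

δ⁻¹ : ℕ → ℚ
δ⁻¹ j = (1/ δ j) {{ℚ.pos⇒nonZero (δ j) {{δ-positive j}}}}

δ-inverse : ∀ j → δ j * δ⁻¹ j ≡ 1ℚ
δ-inverse j = ℚ.*-inverseʳ (δ j) {{ℚ.pos⇒nonZero (δ j) {{δ-positive j}}}}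

β : ℕ → ℚ
β j = δ j * δ⁻¹ (suc j)

μ : ℕ → ℚ
μ j = pow₃ j * δ⁻¹ j

ν : ℕ → ℚ
ν j = 3 * pow₃ j - 3

exitTime : ℕ → ℚ
exitTime j = 3 * δ j

β-μ : ∀ j → β j * (5 + 3 * μ j) ≡ 1ℚ
β-μ j = begin
  β j * (5 + 3 * μ j)                                      ≡⟨ expand (δ j) (pow₃ j) (δ⁻¹ j) (δ⁻¹ (suc j)) ⟩
  δ (suc j) * δ⁻¹ (suc j) + 3 * pow₃ j * δ⁻¹ (suc j) * (δ j * δ⁻¹ j - 1)
                                                           ≡⟨ cong₂ (λ u v → u + 3 * pow₃ j * δ⁻¹ (suc j) * (v - 1)) (δ-inverse (suc j)) (δ-inverse j) ⟩
  1 + 3 * pow₃ j * δ⁻¹ (suc j) * (1 - 1)                  ≡⟨ vanish (3 * pow₃ j * δ⁻¹ (suc j)) ⟩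
  1                                                        ∎
  where
  open ≡-Reasoning
  expand : ∀ d m i i′ → d * i′ * (5 + 3 * (m * i)) ≡ (5 * d + 3 * m) * i′ + 3 * m * i′ * (d * i - 1)
  expand = solve-∀ ℚ-ring
  vanish : ∀ x → 1 + x * (1 - 1) ≡ 1
  vanish = solve-∀ ℚ-ring

μ-exitTime : ∀ j → μ j * exitTime j ≡ ν j + 3
μ-exitTime j = begin
  μ j * exitTime j                 ≡⟨ regroup (pow₃ j) (δ j) (δ⁻¹ j) ⟩
  3 * pow₃ j * (δ j * δ⁻¹ j)      ≡⟨ cong (3 * pow₃ j *_) (δ-inverse j) ⟩
  3 * pow₃ j * 1                   ≡⟨ shift (pow₃ j) ⟩
  ν j + 3                          ∎
  where
  open ≡-Reasoning
  regroup : ∀ m d i → m * i * (3 * d) ≡ 3 * m * (d * i)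
  regroup = solve-∀ ℚ-ring
  shift : ∀ m → 3 * m * 1 ≡ 3 * m - 3 + 3
  shift = solve-∀ ℚ-ring

μ-suc : ∀ j → μ (suc j) ≡ 3 * μ j * β j
μ-suc j = begin
  3 * pow₃ j * δ⁻¹ (suc j)                        ≡⟨ ℚ.*-identityʳ _ ⟨
  3 * pow₃ j * δ⁻¹ (suc j) * 1                    ≡⟨ cong (3 * pow₃ j * δ⁻¹ (suc j) *_) (δ-inverse j) ⟨
  3 * pow₃ j * δ⁻¹ (suc j) * (δ j * δ⁻¹ j)       ≡⟨ regroup (pow₃ j) (δ j) (δ⁻¹ j) (δ⁻¹ (suc j)) ⟩
  3 * μ j * β j                                    ∎
  where
  open ≡-Reasoning
  regroup : ∀ m d i i′ → 3 * m * i′ * (d * i) ≡ 3 * (m * i) * (d * i′)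
  regroup = solve-∀ ℚ-ring

ν-suc : ∀ j → ν (suc j) ≡ ν j + 2 * μ j * exitTime j
ν-suc j = begin
  3 * (3 * pow₃ j) - 3                             ≡⟨ split (pow₃ j) ⟩
  ν j + 2 * (3 * pow₃ j * 1)                       ≡⟨ cong (λ u → ν j + 2 * (3 * pow₃ j * u)) (δ-inverse j) ⟨
  ν j + 2 * (3 * pow₃ j * (δ j * δ⁻¹ j))          ≡⟨ cong (ν j +_) (regroup (pow₃ j) (δ j) (δ⁻¹ j)) ⟩
  ν j + 2 * μ j * exitTime j                       ∎
  where
  open ≡-Reasoning
  split : ∀ m → 3 * (3 * m) - 3 ≡ 3 * m - 3 + 2 * (3 * m * 1)
  split = solve-∀ ℚ-ring
  regroup : ∀ m d i → 2 * (3 * m * (d * i)) ≡ 2 * (m * i) * (3 * d)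
  regroup = solve-∀ ℚ-ring

Corners : Set
Corners = Peg → ℚ

exitValue : ℕ → ℚ → ℚ → ℚ → ℚ
exitValue j x y z = (1 - 3 * β j) * x + β j * y + 2 * β j * z + exitTime j

-- With the larger disks fixed, X r is the potential when disks 0..j+1 form a tower on r, and
-- descend j X p r is the potential when disk j+1 is on p and disks 0..j form a tower on r.
descend : ℕ → Corners → Peg → Corners
descend j X p r = if eqP p r then X r else exitValue j (X p) (X r) (X (third p r))

towerValues : {m : ℕ} → ℕ → State m → Corners → Corners
towerValues j []      X = X
towerValues j (p ∷ t) X = descend j (towerValues (suc j) t X) p

othersSum : Peg → Corners → ℚ
othersSum peg₁ X = X peg₂ + X peg₃
othersSum peg₂ X = X peg₁ + X peg₃
othersSum peg₃ X = X peg₁ + X peg₂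

-- neighbourSum j X r is the sum of the potential over the two moves of the smallest disk when
-- disks 0..j form a tower on r with corner values X (neighbourSum-zero, neighbourSum-tower).
neighbourSum : ℕ → Corners → Peg → ℚ
neighbourSum j Y r = (2 - 2 * μ j) * Y r + μ j * othersSum r Y + ν j

neighbour-step : ∀ j x y z →
  (2 - 2 * μ j) * x + μ j * (exitValue j x y z + exitValue j x z y) + ν j ≡
  (2 - 2 * μ (suc j)) * x + μ (suc j) * (y + z) + ν (suc j)
neighbour-step j x y z = trans (collect x y z (μ j) (β j) (ν j) (exitTime j))
  (sym (cong₂ (λ a b → (2 - 2 * a) * x + a * (y + z) + b) (μ-suc j) (ν-suc j)))
  where
  collect : ∀ x y z μ β ν t → let E = λ a b c → (1 - 3 * β) * a + β * b + 2 * β * c + t in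
    (2 - 2 * μ) * x + μ * (E x y z + E x z y) + ν ≡ (2 - 2 * (3 * μ * β)) * x + 3 * μ * β * (y + z) + (ν + 2 * μ * t)
  collect = solve-∀ ℚ-ring

descend-keep : ∀ j X r → descend j X r r ≡ X r
descend-keep j X r rewrite eqP-refl r = refl

towerValues-keep : ∀ k j X r → towerValues j (replicate k r) X r ≡ X r
towerValues-keep zero    j X r = refl
towerValues-keep (suc k) j X r = trans (descend-keep j (towerValues (suc j) (replicate k r) X) r) (towerValues-keep k (suc j) X r)

neighbourSum-descend : ∀ j Y r → neighbourSum j (descend j Y r) r ≡ neighbourSum (suc j) Y r
neighbourSum-descend j Y peg₁ = neighbour-step j (Y peg₁) (Y peg₂) (Y peg₃)
neighbourSum-descend j Y peg₂ = neighbour-step j (Y peg₂) (Y peg₁) (Y peg₃)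
neighbourSum-descend j Y peg₃ = neighbour-step j (Y peg₃) (Y peg₁) (Y peg₂)

neighbourSum-tower : ∀ k j X r → neighbourSum j (towerValues j (replicate k r) X) r ≡ neighbourSum (j ℕ.+ k) X r
neighbourSum-tower zero    j X r = cong (λ i → neighbourSum i X r) (sym (ℕ.+-identityʳ j))
neighbourSum-tower (suc k) j X r = begin
  neighbourSum j (descend j (towerValues (suc j) (replicate k r) X) r) r ≡⟨ neighbourSum-descend j (towerValues (suc j) (replicate k r) X) r ⟩
  neighbourSum (suc j) (towerValues (suc j) (replicate k r) X) r         ≡⟨ neighbourSum-tower k (suc j) X r ⟩
  neighbourSum (suc j ℕ.+ k) X r                                         ≡⟨ cong (λ i → neighbourSum i X r) (ℕ.+-suc j k) ⟨
  neighbourSum (j ℕ.+ suc k) X r                                         ∎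
  where open ≡-Reasoning

neighbourSum-zero : ∀ Y r → neighbourSum 0 Y r ≡ othersSum r Y
neighbourSum-zero Y r = simplify (Y r) (othersSum r Y)
  where
  simplify : ∀ y s → 0ℚ * y + 1ℚ * s + 0ℚ ≡ s
  simplify = solve-∀ ℚ-ring

-- The mean over the three moves of a state whose smallest disk is on r and whose first disk
-- off r is disk j+1, lying on p: x, y and z are the corner values at p, r and the third peg.
blocker-balance : ∀ j x y z S → S ≡ x + exitValue j x z y →
  inv 3 * ((2 - 2 * μ j) * exitValue j x y z + μ j * S + ν j + exitValue j z y x) ≡ exitValue j x y z - 1
blocker-balance j x y z S refl = begin
  inv 3 * ((2 - 2 * μ j) * exitValue j x y z + μ j * (x + exitValue j x z y) + ν j + exitValue j z y x)
    ≡⟨ regroup x y z (μ j) (β j) (ν j) (exitTime j) ⟩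
  inv 3 * (3 * (exitValue j x y z - 1) + (x - z) * (β j * (5 + 3 * μ j) - 1) + (ν j + 3 - μ j * exitTime j))
    ≡⟨ cong₂ (λ u v → inv 3 * (3 * (exitValue j x y z - 1) + (x - z) * (u - 1) + (ν j + 3 - v))) (β-μ j) (μ-exitTime j) ⟩
  inv 3 * (3 * (exitValue j x y z - 1) + (x - z) * (1ℚ - 1) + (ν j + 3 - (ν j + 3)))
    ≡⟨ cancel (exitValue j x y z) (x - z) (ν j + 3) ⟩
  exitValue j x y z - 1 ∎
  where
  open ≡-Reasoning
  regroup : ∀ x y z μ β ν t → let E = λ a b c → (1 - 3 * β) * a + β * b + 2 * β * c + t in
    inv 3 * ((2 - 2 * μ) * E x y z + μ * (x + E x z y) + ν + E z y x) ≡
    inv 3 * (3 * (E x y z - 1) + (x - z) * (β * (5 + 3 * μ) - 1) + (ν + 3 - μ * t))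
  regroup = solve-∀ ℚ-ring
  cancel : ∀ e w c → inv 3 * (3 * (e - 1) + w * (1 - 1) + (c - c)) ≡ e - 1
  cancel = solve-∀ ℚ-ring

firstOff-balance : ∀ {r m} {t : State m} (off : FirstOff r t) j X →
  inv 3 * (neighbourSum j (towerValues j t X) r + towerValues j (bridge off) X r) ≡ towerValues j t X r - 1
firstOff-balance {r} (here {p = p} {rest} r≢p) j X = balance r p r≢p
  where
  E : Corners
  E = towerValues (suc j) rest X
  balance : ∀ r p → r ≢ p →
    inv 3 * (neighbourSum j (descend j E p) r + descend j E (third r p) r) ≡ descend j E p r - 1
  balance peg₁ peg₁ r≢p = ⊥-elim (r≢p refl)
  balance peg₂ peg₂ r≢p = ⊥-elim (r≢p refl)
  balance peg₃ peg₃ r≢p = ⊥-elim (r≢p refl)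
  balance peg₁ peg₂ _ = blocker-balance j (E peg₂) (E peg₁) (E peg₃) _ refl
  balance peg₂ peg₁ _ = blocker-balance j (E peg₁) (E peg₂) (E peg₃) _ refl
  balance peg₃ peg₁ _ = blocker-balance j (E peg₁) (E peg₃) (E peg₂) _ refl
  balance peg₁ peg₃ _ = blocker-balance j (E peg₃) (E peg₁) (E peg₂) _ (ℚ.+-comm (exitValue j (E peg₃) (E peg₂) (E peg₁)) (E peg₃))
  balance peg₂ peg₃ _ = blocker-balance j (E peg₃) (E peg₂) (E peg₁) _ (ℚ.+-comm (exitValue j (E peg₃) (E peg₁) (E peg₂)) (E peg₃))
  balance peg₃ peg₂ _ = blocker-balance j (E peg₂) (E peg₃) (E peg₁) _ (ℚ.+-comm (exitValue j (E peg₂) (E peg₁) (E peg₃)) (E peg₂))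
firstOff-balance {r} (there {t = t} off) j X = begin
  inv 3 * (neighbourSum j (descend j V r) r + descend j W r r)
    ≡⟨ cong₂ (λ a b → inv 3 * (a + b)) (neighbourSum-descend j V r) (descend-keep j W r) ⟩
  inv 3 * (neighbourSum (suc j) V r + W r)  ≡⟨ firstOff-balance off (suc j) X ⟩
  V r - 1                                   ≡⟨ cong (_- 1ℚ) (descend-keep j V r) ⟨
  descend j V r r - 1                       ∎
  where
  open ≡-Reasoning
  V W : Corners
  V = towerValues (suc j) t X
  W = towerValues (suc j) (bridge off) X

Σ-smallestDiskMoves : ∀ {m} r (t : State m) (f : State (suc m) → ℚ) →
                  Σ (smallestDiskMoves r t) f ≡ othersSum r (λ q → f (q ∷ t))
Σ-smallestDiskMoves peg₁ t f = cong (f (peg₂ ∷ t) +_) (ℚ.+-identityʳ _)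
Σ-smallestDiskMoves peg₂ t f = cong (f (peg₁ ∷ t) +_) (ℚ.+-identityʳ _)
Σ-smallestDiskMoves peg₃ t f = cong (f (peg₁ ∷ t) +_) (ℚ.+-identityʳ _)

length-smallestDiskMoves : ∀ {m} r (t : State m) → length (smallestDiskMoves r t) ≡ 2
length-smallestDiskMoves peg₁ t = refl
length-smallestDiskMoves peg₂ t = refl
length-smallestDiskMoves peg₃ t = refl

average-successors-∷ : ∀ {m} r (t : State m) (f : State (suc m) → ℚ) →
  average (successors (r ∷ t)) f ≡
  inv (2 ℕ.+ length (movesAvoiding r t)) * (othersSum r (λ q → f (q ∷ t)) + Σ (movesAvoiding r t) (λ u → f (r ∷ u)))
average-successors-∷ r t f rewrite successors-∷ r t = cong₂ _*_
  (cong inv (trans (List.length-++ (smallestDiskMoves r t)) (cong₂ ℕ._+_ (length-smallestDiskMoves r t) (List.length-map (r ∷_) (movesAvoiding r t)))))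
  (trans (Σ-++ (smallestDiskMoves r t) _ f) (cong₂ _+_ (Σ-smallestDiskMoves r t f) (Σ-map (r ∷_) (movesAvoiding r t) f)))

pow₃⁻¹ : ℕ → ℚ
pow₃⁻¹ j = (1/ pow₃ j) {{ℚ.pos⇒nonZero (pow₃ j) {{pow₃-positive j}}}}

pow₃-inverse : ∀ j → pow₃ j * pow₃⁻¹ j ≡ 1ℚ
pow₃-inverse j = ℚ.*-inverseʳ (pow₃ j) {{ℚ.pos⇒nonZero (pow₃ j) {{pow₃-positive j}}}}

-- The value of the potential at the tower of all L+1 disks on peg 2 or 3.
towerTime : ℕ → ℚ
towerTime L = (ν L + 2) * δ L * pow₃⁻¹ L

μ-towerTime : ∀ L → μ L * towerTime L ≡ ν L + 2
μ-towerTime L = begin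
  μ L * towerTime L                                  ≡⟨ regroup (pow₃ L) (δ L) (δ⁻¹ L) (pow₃⁻¹ L) (ν L + 2) ⟩
  (ν L + 2) * (δ L * δ⁻¹ L) * (pow₃ L * pow₃⁻¹ L)    ≡⟨ cong₂ (λ a b → (ν L + 2) * a * b) (δ-inverse L) (pow₃-inverse L) ⟩
  (ν L + 2) * 1ℚ * 1ℚ                                ≡⟨ unit (ν L + 2) ⟩
  ν L + 2                                            ∎
  where
  open ≡-Reasoning
  regroup : ∀ m d d⁻¹ m⁻¹ c → m * d⁻¹ * (c * d * m⁻¹) ≡ c * (d * d⁻¹) * (m * m⁻¹)
  regroup = solve-∀ ℚ-ring
  unit : ∀ c → c * 1ℚ * 1ℚ ≡ c
  unit = solve-∀ ℚ-ring

goalCorners : ℕ → Corners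
goalCorners L peg₁         = 0ℚ
goalCorners L (Fin.suc _)  = towerTime L

potential : {m : ℕ} → Corners → State (suc m) → ℚ
potential a (r ∷ t) = towerValues 0 t a r

tower-balance : ∀ L r → r ≢ peg₁ →
  inv 2 * (neighbourSum L (goalCorners L) r + 0ℚ) ≡ goalCorners L r - 1
tower-balance L peg₁ r≢peg₁ = ⊥-elim (r≢peg₁ refl)
tower-balance L peg₂ _      = balance
  where
  open ≡-Reasoning
  T : ℚ
  T = towerTime L
  balance : inv 2 * ((2 - 2 * μ L) * T + μ L * (0ℚ + T) + ν L + 0ℚ) ≡ T - 1
  balance = begin
    inv 2 * ((2 - 2 * μ L) * T + μ L * (0ℚ + T) + ν L + 0ℚ) ≡⟨ regroup T (μ L) (ν L) ⟩
    T - 1 + inv 2 * (ν L + 2 - μ L * T)                     ≡⟨ cong (λ v → T - 1 + inv 2 * (ν L + 2 - v)) (μ-towerTime L) ⟩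
    T - 1 + inv 2 * (ν L + 2 - (ν L + 2))                   ≡⟨ cancel T (ν L + 2) ⟩
    T - 1                                                   ∎
    where
    regroup : ∀ T μ ν → inv 2 * ((2 - 2 * μ) * T + μ * (0ℚ + T) + ν + 0ℚ) ≡ T - 1 + inv 2 * (ν + 2 - μ * T)
    regroup = solve-∀ ℚ-ring
    cancel : ∀ T c → T - 1 + inv 2 * (c - c) ≡ T - 1
    cancel = solve-∀ ℚ-ring
-- goalCorners L takes the same value on pegs 2 and 3.
tower-balance L peg₃ _      = tower-balance L peg₂ (λ ())

firstOff-harmonic : ∀ L r (t : State L) → FirstOff r t →
  average (successors (r ∷ t)) (potential (goalCorners L)) ≡ potential (goalCorners L) (r ∷ t) - 1
firstOff-harmonic L r t off = begin
  average (successors (r ∷ t)) f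
    ≡⟨ average-successors-∷ r t f ⟩
  inv (2 ℕ.+ length (movesAvoiding r t)) * (othersSum r V + Σ (movesAvoiding r t) (λ u → f (r ∷ u)))
    ≡⟨ cong (λ us → inv (2 ℕ.+ length us) * (othersSum r V + Σ us (λ u → f (r ∷ u)))) (movesAvoiding-firstOff off) ⟩
  inv 3 * (othersSum r V + (W r + 0ℚ))
    ≡⟨ cong (inv 3 *_) (cong₂ _+_ (neighbourSum-zero V r) (sym (ℚ.+-identityʳ (W r)))) ⟨
  inv 3 * (neighbourSum 0 V r + W r)
    ≡⟨ firstOff-balance off 0 a ⟩
  V r - 1 ∎
  where
  open ≡-Reasoning
  a : Corners
  a = goalCorners L
  f : State (suc L) → ℚ
  f = potential a
  V W : Corners
  V = towerValues 0 t a
  W = towerValues 0 (bridge off) a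

tower-harmonic : ∀ L r → r ≢ peg₁ →
  average (successors (r ∷ replicate L r)) (potential (goalCorners L)) ≡ potential (goalCorners L) (r ∷ replicate L r) - 1
tower-harmonic L r r≢peg₁ = begin
  average (successors (r ∷ replicate L r)) f
    ≡⟨ average-successors-∷ r (replicate L r) f ⟩
  inv (2 ℕ.+ length (movesAvoiding r (replicate L r))) * (othersSum r V + Σ (movesAvoiding r (replicate L r)) (λ u → f (r ∷ u)))
    ≡⟨ cong (λ us → inv (2 ℕ.+ length us) * (othersSum r V + Σ us (λ u → f (r ∷ u)))) (movesAvoiding-tower r L) ⟩
  inv 2 * (othersSum r V + 0ℚ)
    ≡⟨ cong (λ x → inv 2 * (x + 0ℚ)) (trans (sym (neighbourSum-zero V r)) (neighbourSum-tower L 0 a r)) ⟩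
  inv 2 * (neighbourSum L a r + 0ℚ)
    ≡⟨ tower-balance L r r≢peg₁ ⟩
  a r - 1
    ≡⟨ cong (_- 1ℚ) (towerValues-keep L 0 a r) ⟨
  V r - 1 ∎
  where
  open ≡-Reasoning
  a : Corners
  a = goalCorners L
  f : State (suc L) → ℚ
  f = potential a
  V : Corners
  V = towerValues 0 (replicate L r) a

potential-harmonic : ∀ L (s : State (suc L)) → s ≢ goal (suc L) →
  average (successors s) (potential (goalCorners L)) ≡ potential (goalCorners L) s - 1
potential-harmonic L (r ∷ t) s≢goal with tower-or-firstOff r t
... | inj₂ off  = firstOff-harmonic L r t off
... | inj₁ refl = tower-harmonic L r (λ r≡peg₁ → s≢goal (cong (λ x → x ∷ replicate L x) r≡peg₁))

β-nonNeg : ∀ j → 0ℚ ≤ β j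
β-nonNeg j = *-nonNeg (positive⇒nonNeg (δ j) {{δ-positive j}})
  (positive⇒nonNeg (δ⁻¹ (suc j)) {{ℚ.1/pos⇒pos (δ (suc j)) {{δ-positive (suc j)}}}})

μ-nonNeg : ∀ j → 0ℚ ≤ μ j
μ-nonNeg j = *-nonNeg (positive⇒nonNeg (pow₃ j) {{pow₃-positive j}})
  (positive⇒nonNeg (δ⁻¹ j) {{ℚ.1/pos⇒pos (δ j) {{δ-positive j}}}})

exitTime-nonNeg : ∀ j → 0ℚ ≤ exitTime j
exitTime-nonNeg j = *-nonNeg (fromℕ-nonNeg 3) (positive⇒nonNeg (δ j) {{δ-positive j}})

stay-nonNeg : ∀ j → 0ℚ ≤ 1 - 3 * β j
stay-nonNeg j = subst (0ℚ ≤_) (trans (sym (factor (β j) (μ j))) (cong (_- 3 * β j) (β-μ j)))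
  (*-nonNeg (β-nonNeg j) (+-nonNeg (fromℕ-nonNeg 2) (*-nonNeg (fromℕ-nonNeg 3) (μ-nonNeg j))))
  where
  factor : ∀ b m → b * (5 + 3 * m) - 3 * b ≡ b * (2 + 3 * m)
  factor = solve-∀ ℚ-ring

ν-nonNeg : ∀ j → 0ℚ ≤ ν j
ν-nonNeg zero    = ℚ.≤-refl
ν-nonNeg (suc j) = subst (0ℚ ≤_) (sym (ν-suc j))
  (+-nonNeg (ν-nonNeg j) (*-nonNeg (*-nonNeg (fromℕ-nonNeg 2) (μ-nonNeg j)) (exitTime-nonNeg j)))

towerTime-nonNeg : ∀ L → 0ℚ ≤ towerTime L
towerTime-nonNeg L = *-nonNeg (*-nonNeg (+-nonNeg (ν-nonNeg L) (fromℕ-nonNeg 2)) (positive⇒nonNeg (δ L) {{δ-positive L}}))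
  (positive⇒nonNeg (pow₃⁻¹ L) {{ℚ.1/pos⇒pos (pow₃ L) {{pow₃-positive L}}}})

NonNegCorners : Corners → Set
NonNegCorners X = ∀ r → 0ℚ ≤ X r

exitValue-nonNeg : ∀ j {x y z} → 0ℚ ≤ x → 0ℚ ≤ y → 0ℚ ≤ z → 0ℚ ≤ exitValue j x y z
exitValue-nonNeg j x≥0 y≥0 z≥0 =
  +-nonNeg (+-nonNeg (+-nonNeg (*-nonNeg (stay-nonNeg j) x≥0) (*-nonNeg (β-nonNeg j) y≥0))
                     (*-nonNeg (*-nonNeg (fromℕ-nonNeg 2) (β-nonNeg j)) z≥0))
           (exitTime-nonNeg j)

descend-nonNeg : ∀ j {X} p → NonNegCorners X → NonNegCorners (descend j X p)
descend-nonNeg j p X≥0 r with eqP p r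
... | true  = X≥0 r
... | false = exitValue-nonNeg j (X≥0 p) (X≥0 r) (X≥0 (third p r))

towerValues-nonNeg : ∀ {m} j (t : State m) {X} → NonNegCorners X → NonNegCorners (towerValues j t X)
towerValues-nonNeg j []      X≥0 = X≥0
towerValues-nonNeg j (p ∷ t) X≥0 = descend-nonNeg j p (towerValues-nonNeg (suc j) t X≥0)

goalCorners-nonNeg : ∀ L → NonNegCorners (goalCorners L)
goalCorners-nonNeg L peg₁        = ℚ.≤-refl
goalCorners-nonNeg L (Fin.suc _) = towerTime-nonNeg L

hanoiPotential : (L : ℕ) → HittingPotential (suc L)
hanoiPotential L = record
  { h          = potential (goalCorners L)
  ; h-goal     = towerValues-keep L 0 (goalCorners L) peg₁
  ; h-nonNeg   = λ { (r ∷ t) → towerValues-nonNeg 0 t (goalCorners-nonNeg L) r }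
  ; h-harmonic = potential-harmonic L
  }

-- Summing the potential

cornerSum : Corners → ℚ
cornerSum X = Σ (allFin 3) X

exitTimes : ℕ → ℕ → ℚ
exitTimes j zero    = 0ℚ
exitTimes j (suc L) = exitTime j + exitTimes (suc j) L

cornerSum-descend : ∀ j Y → Σ (allFin 3) (λ p → cornerSum (descend j Y p)) ≡ 3 * cornerSum Y + 6 * exitTime j
cornerSum-descend j Y = collect (Y peg₁) (Y peg₂) (Y peg₃) (β j) (exitTime j)
  where
  collect : ∀ a b c β t → let E = λ x y z → (1 - 3 * β) * x + β * y + 2 * β * z + t in
    (a + (E a b c + (E a c b + 0ℚ))) + ((E b a c + (b + (E b c a + 0ℚ))) + ((E c a b + (E c b a + (c + 0ℚ))) + 0ℚ))
    ≡ 3 * (a + (b + (c + 0ℚ))) + 6 * t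
  collect = solve-∀ ℚ-ring

Σ-allStates-const : ∀ L c → Σ (allStates L) (λ _ → c) ≡ pow₃ L * c
Σ-allStates-const zero    c = trans (ℚ.+-identityʳ c) (sym (ℚ.*-identityˡ c))
Σ-allStates-const (suc L) c = begin
  Σ (allStates (suc L)) (λ _ → c)                  ≡⟨ Σ-allStates-suc L (λ _ → c) ⟩
  Σ (allFin 3) (λ _ → Σ (allStates L) (λ _ → c))   ≡⟨ Σ-cong (allFin 3) (λ _ → Σ-allStates-const L c) ⟩
  Σ (allFin 3) (λ _ → pow₃ L * c)                  ≡⟨ triple (pow₃ L) c ⟩
  pow₃ (suc L) * c                                 ∎
  where
  open ≡-Reasoning
  triple : ∀ m c → m * c + (m * c + (m * c + 0ℚ)) ≡ 3 * m * c
  triple = solve-∀ ℚ-ring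

cornerSum-towerValues : ∀ L j X →
  Σ (allStates L) (λ t → cornerSum (towerValues j t X)) ≡ pow₃ L * (cornerSum X + 2 * exitTimes j L)
cornerSum-towerValues zero    j X = base (cornerSum X)
  where
  base : ∀ c → c + 0ℚ ≡ 1 * (c + 2 * 0ℚ)
  base = solve-∀ ℚ-ring
cornerSum-towerValues (suc L) j X = begin
  Σ (allStates (suc L)) (λ t → cornerSum (towerValues j t X))
    ≡⟨ Σ-allStates-suc L (λ t → cornerSum (towerValues j t X)) ⟩
  Σ (allFin 3) (λ p → Σ (allStates L) (λ t → cornerSum (descend j (Y t) p)))
    ≡⟨ Σ-comm (allFin 3) (allStates L) (λ p t → cornerSum (descend j (Y t) p)) ⟩
  Σ (allStates L) (λ t → Σ (allFin 3) (λ p → cornerSum (descend j (Y t) p)))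
    ≡⟨ Σ-cong (allStates L) (λ t → cornerSum-descend j (Y t)) ⟩
  Σ (allStates L) (λ t → 3 * cornerSum (Y t) + 6 * exitTime j)
    ≡⟨ Σ-distrib-+ (allStates L) (λ t → 3 * cornerSum (Y t)) (λ _ → 6 * exitTime j) ⟩
  Σ (allStates L) (λ t → 3 * cornerSum (Y t)) + Σ (allStates L) (λ _ → 6 * exitTime j)
    ≡⟨ cong₂ _+_ (sym (*-distribˡ-Σ 3 (allStates L) (λ t → cornerSum (Y t)))) (Σ-allStates-const L (6 * exitTime j)) ⟩
  3 * Σ (allStates L) (λ t → cornerSum (Y t)) + pow₃ L * (6 * exitTime j)
    ≡⟨ cong (λ v → 3 * v + pow₃ L * (6 * exitTime j)) (cornerSum-towerValues L (suc j) X) ⟩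
  3 * (pow₃ L * (cornerSum X + 2 * exitTimes (suc j) L)) + pow₃ L * (6 * exitTime j)
    ≡⟨ collect (pow₃ L) (cornerSum X) (exitTimes (suc j) L) (exitTime j) ⟩
  pow₃ (suc L) * (cornerSum X + 2 * exitTimes j (suc L)) ∎
  where
  open ≡-Reasoning
  Y : State L → Corners
  Y t = towerValues (suc j) t X
  collect : ∀ m c e t → 3 * (m * (c + 2 * e)) + m * (6 * t) ≡ 3 * m * (c + 2 * (t + e))
  collect = solve-∀ ℚ-ring

Σ-potential : ∀ L a → Σ (allStates (suc L)) (potential a) ≡ pow₃ L * (cornerSum a + 2 * exitTimes 0 L)
Σ-potential L a = begin
  Σ (allStates (suc L)) (potential a)                                 ≡⟨ Σ-allStates-suc L (potential a) ⟩
  Σ (allFin 3) (λ p → Σ (allStates L) (λ t → towerValues 0 t a p))    ≡⟨ Σ-comm (allFin 3) (allStates L) (λ p t → towerValues 0 t a p) ⟩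
  Σ (allStates L) (λ t → cornerSum (towerValues 0 t a))               ≡⟨ cornerSum-towerValues L 0 a ⟩
  pow₃ L * (cornerSum a + 2 * exitTimes 0 L)                          ∎
  where open ≡-Reasoning

-- Closed forms

pow₃-fromℕ : ∀ j → pow₃ j ≡ fromℕ (3 ^ j)
pow₃-fromℕ zero    = refl
pow₃-fromℕ (suc j) = trans (cong (3 *_) (pow₃-fromℕ j)) (sym (fromℕ-* 3 (3 ^ j)))

δ-closed : ∀ j → 2 * δ j ≡ 5 * fromℕ (5 ^ j) - 3 * pow₃ j
δ-closed zero    = refl
δ-closed (suc j) = begin
  2 * (5 * δ j + 3 * pow₃ j)                        ≡⟨ regroup (δ j) (pow₃ j) ⟩
  5 * (2 * δ j) + 6 * pow₃ j                        ≡⟨ cong (λ v → 5 * v + 6 * pow₃ j) (δ-closed j) ⟩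
  5 * (5 * fromℕ (5 ^ j) - 3 * pow₃ j) + 6 * pow₃ j ≡⟨ collect (fromℕ (5 ^ j)) (pow₃ j) ⟩
  5 * (5 * fromℕ (5 ^ j)) - 3 * pow₃ (suc j)        ≡⟨ cong (λ v → 5 * v - 3 * pow₃ (suc j)) (fromℕ-* 5 (5 ^ j)) ⟨
  5 * fromℕ (5 ^ suc j) - 3 * pow₃ (suc j)          ∎
  where
  open ≡-Reasoning
  regroup : ∀ d m → 2 * (5 * d + 3 * m) ≡ 5 * (2 * d) + 6 * m
  regroup = solve-∀ ℚ-ring
  collect : ∀ x m → 5 * (5 * x - 3 * m) + 6 * m ≡ 5 * (5 * x) - 3 * (3 * m)
  collect = solve-∀ ℚ-ring

exitTimes-snoc : ∀ L j → exitTimes j (suc L) ≡ exitTimes j L + exitTime (j ℕ.+ L)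
exitTimes-snoc zero    j = trans (ℚ.+-comm (exitTime j) 0ℚ) (cong (λ i → 0ℚ + exitTime i) (sym (ℕ.+-identityʳ j)))
exitTimes-snoc (suc L) j = begin
  exitTime j + exitTimes (suc j) (suc L)                         ≡⟨ cong (exitTime j +_) (exitTimes-snoc L (suc j)) ⟩
  exitTime j + (exitTimes (suc j) L + exitTime (suc j ℕ.+ L))    ≡⟨ ℚ.+-assoc (exitTime j) _ _ ⟨
  exitTime j + exitTimes (suc j) L + exitTime (suc j ℕ.+ L)      ≡⟨ cong (λ i → exitTime j + exitTimes (suc j) L + exitTime i) (ℕ.+-suc j L) ⟨
  exitTime j + exitTimes (suc j) L + exitTime (j ℕ.+ suc L)      ∎
  where open ≡-Reasoning

exitTimes-closed : ∀ L → 8 * exitTimes 0 L ≡ 3 * (5 * fromℕ (5 ^ L) - 6 * pow₃ L + 1)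
exitTimes-closed zero    = refl
exitTimes-closed (suc L) = begin
  8 * exitTimes 0 (suc L)                                                  ≡⟨ cong (8 *_) (exitTimes-snoc L 0) ⟩
  8 * (exitTimes 0 L + 3 * δ L)                                            ≡⟨ regroup (exitTimes 0 L) (δ L) ⟩
  8 * exitTimes 0 L + 12 * (2 * δ L)                                       ≡⟨ cong₂ (λ u v → u + 12 * v) (exitTimes-closed L) (δ-closed L) ⟩
  3 * (5 * X - 6 * pow₃ L + 1) + 12 * (5 * X - 3 * pow₃ L)                 ≡⟨ collect X (pow₃ L) ⟩
  3 * (5 * (5 * X) - 6 * pow₃ (suc L) + 1)                                 ≡⟨ cong (λ v → 3 * (5 * v - 6 * pow₃ (suc L) + 1)) (fromℕ-* 5 (5 ^ L)) ⟨
  3 * (5 * fromℕ (5 ^ suc L) - 6 * pow₃ (suc L) + 1)                       ∎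
  where
  open ≡-Reasoning
  X : ℚ
  X = fromℕ (5 ^ L)
  regroup : ∀ e d → 8 * (e + 3 * d) ≡ 8 * e + 12 * (2 * d)
  regroup = solve-∀ ℚ-ring
  collect : ∀ x m → 3 * (5 * x - 6 * m + 1) + 12 * (5 * x - 3 * m) ≡ 3 * (5 * (5 * x) - 6 * (3 * m) + 1)
  collect = solve-∀ ℚ-ring

module _ (L : ℕ) where

  private
    n : ℕ
    n = suc L
    X m i T e : ℚ
    X = fromℕ (5 ^ L)
    m = pow₃ L
    i = inv (3 ^ n)
    T = towerTime L
    e = exitTimes 0 L

    three-m : fromℕ (3 ^ n) ≡ 3 * m
    three-m = trans (fromℕ-* 3 (3 ^ L)) (cong (3 *_) (sym (pow₃-fromℕ L)))

    i-3m : i * (3 * m) ≡ 1ℚ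
    i-3m = trans (cong (i *_) (sym three-m)) (inv-*-cancel (3 ^ n) {{ℕ.m^n≢0 3 n}})

    five-X : fromℕ (5 ^ n) ≡ 5 * X
    five-X = fromℕ-* 5 (5 ^ L)

    A D : ℤ
    A = ℤ.+ (3 ^ n) ℤ.- ℤ.+ 1
    D = ℤ.+ (5 ^ suc n) ℤ.- ℤ.+ (2 ℕ.* 3 ^ suc n)

    difference : fromℤ D ≡ 5 * (5 * X) - 2 * (3 * (3 * m))
    difference = trans (fromℤ-- (ℤ.+ (5 ^ suc n)) (ℤ.+ (2 ℕ.* 3 ^ suc n))) (cong₂ _-_
      (trans (fromℕ-* 5 (5 ^ n)) (cong (5 *_) five-X))
      (trans (fromℕ-* 2 (3 ^ suc n)) (cong (2 *_) (trans (fromℕ-* 3 (3 ^ n)) (cong (3 *_) three-m)))))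

  formula1-expanded : formula1 n ≡ (5 * (5 * X) - 2 * (3 * (3 * m)) + 5) * inv 4 - 5 * X * i
  formula1-expanded = cong₂ _-_
    (trans (/-as-* (D ℤ.+ ℤ.+ 5) 4) (cong (_* inv 4) (trans (fromℤ-+ D (ℤ.+ 5)) (cong (_+ 5) difference))))
    (trans (/-as-* (ℤ.+ (5 ^ n)) (3 ^ n) {{ℕ.m^n≢0 3 n}}) (cong (_* i) five-X))

  formula2-expanded : formula2 n ≡ ((3 * m - 1) * (5 * (5 * X) - 2 * (3 * (3 * m))) + 5 * X - 3 * m) * i * inv 4
  formula2-expanded = cong (_* inv 4) (trans (/-as-* (A ℤ.* D ℤ.+ ℤ.+ (5 ^ n) ℤ.- ℤ.+ (3 ^ n)) (3 ^ n) {{ℕ.m^n≢0 3 n}}) (cong (_* i)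
    (trans (fromℤ-- (A ℤ.* D ℤ.+ ℤ.+ (5 ^ n)) (ℤ.+ (3 ^ n))) (cong₂ _-_
      (trans (fromℤ-+ (A ℤ.* D) (ℤ.+ (5 ^ n))) (cong₂ _+_
        (trans (fromℤ-* A D) (cong₂ _*_ (trans (fromℤ-- (ℤ.+ (3 ^ n)) (ℤ.+ 1)) (cong (_- 1) three-m)) difference))
        five-X))
      three-m))))

  formula1≡formula2 : formula1 n ≡ formula2 n
  formula1≡formula2 = begin
    formula1 n                                                   ≡⟨ formula1-expanded ⟩
    Q - 5 * X * i                                                ≡⟨ cong (_- 5 * X * i) (ℚ.*-identityˡ Q) ⟨
    1ℚ * Q - 5 * X * i                                           ≡⟨ cong (λ u → u * Q - 5 * X * i) i-3m ⟨
    i * (3 * m) * Q - 5 * X * i                                  ≡⟨ regroup i m X ⟩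
    ((3 * m - 1) * (5 * (5 * X) - 2 * (3 * (3 * m))) + 5 * X - 3 * m) * i * inv 4 ≡⟨ formula2-expanded ⟨
    formula2 n                                                   ∎
    where
    open ≡-Reasoning
    Q : ℚ
    Q = (5 * (5 * X) - 2 * (3 * (3 * m)) + 5) * inv 4
    regroup : ∀ i m X → i * (3 * m) * ((5 * (5 * X) - 2 * (3 * (3 * m)) + 5) * inv 4) - 5 * X * i ≡
                        ((3 * m - 1) * (5 * (5 * X) - 2 * (3 * (3 * m))) + 5 * X - 3 * m) * i * inv 4
    regroup = solve-∀ ℚ-ring

  expectedTime : remaining (hanoiPotential L) 0 ≡ formula1 n
  expectedTime = begin
    remaining (hanoiPotential L) 0
      ≡⟨ remaining-zero (hanoiPotential L) ⟩
    i * Σ (allStates n) (potential (goalCorners L))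
      ≡⟨ cong (i *_) (Σ-potential L (goalCorners L)) ⟩
    i * (m * (0ℚ + (T + (T + 0ℚ)) + 2 * e))
      ≡⟨ regroup i m (δ L) (pow₃⁻¹ L) e ⟩
    i * (3 * m - 1) * (2 * δ L) * (m * pow₃⁻¹ L) + i * (3 * m) * (8 * e) * inv 12
      ≡⟨ cong₂ (λ u v → i * (3 * m - 1) * u * v + i * (3 * m) * (8 * e) * inv 12) (δ-closed L) (pow₃-inverse L) ⟩
    i * (3 * m - 1) * (5 * X - 3 * m) * 1ℚ + i * (3 * m) * (8 * e) * inv 12
      ≡⟨ cong (λ u → i * (3 * m - 1) * (5 * X - 3 * m) * 1ℚ + i * (3 * m) * u * inv 12) (exitTimes-closed L) ⟩
    i * (3 * m - 1) * (5 * X - 3 * m) * 1ℚ + i * (3 * m) * (3 * (5 * X - 6 * m + 1)) * inv 12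
      ≡⟨ collect i m X ⟩
    i * (3 * m) * (5 * X - 3 * m + 1 + (5 * X - 6 * m + 1) * inv 4) - 5 * X * i
      ≡⟨ cong (λ u → u * (5 * X - 3 * m + 1 + (5 * X - 6 * m + 1) * inv 4) - 5 * X * i) i-3m ⟩
    1ℚ * (5 * X - 3 * m + 1 + (5 * X - 6 * m + 1) * inv 4) - 5 * X * i
      ≡⟨ simplify m X (5 * X * i) ⟩
    (5 * (5 * X) - 2 * (3 * (3 * m)) + 5) * inv 4 - 5 * X * i
      ≡⟨ formula1-expanded ⟨
    formula1 n ∎
    where
    open ≡-Reasoning
    regroup : ∀ i m d q e → let T = (3 * m - 3 + 2) * d * q in
      i * (m * (0ℚ + (T + (T + 0ℚ)) + 2 * e)) ≡ i * (3 * m - 1) * (2 * d) * (m * q) + i * (3 * m) * (8 * e) * inv 12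
    regroup = solve-∀ ℚ-ring
    collect : ∀ i m X →
      i * (3 * m - 1) * (5 * X - 3 * m) * 1ℚ + i * (3 * m) * (3 * (5 * X - 6 * m + 1)) * inv 12 ≡
      i * (3 * m) * (5 * X - 3 * m + 1 + (5 * X - 6 * m + 1) * inv 4) - 5 * X * i
    collect = solve-∀ ℚ-ring
    simplify : ∀ m X c → 1ℚ * (5 * X - 3 * m + 1 + (5 * X - 6 * m + 1) * inv 4) - c ≡
                         (5 * (5 * X) - 2 * (3 * (3 * m)) + 5) * inv 4 - c
    simplify = solve-∀ ℚ-ring

mainTheorem5 : (n : ℕ) → 1 ℕ.≤ n →
    ConvergesTo (partialExp n) (formula1 n) × formula1 n ≡ formula2 n
mainTheorem5 (suc L) _ =
  subst (ConvergesTo (partialExp (suc L))) (expectedTime L) (partialExp-converges (hanoiPotential L)) ,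
  formula1≡formula2 L
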